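{- Let $G_3^*$ be the greedy set of positive integers free of three-term geometric progressions. Then the upper uniform density of $G_3^*$ is at most $7/8$, i.e. $\overline{u}(G_3^*) \le 7/8$.
   Context: A three-term geometric progression is a triple $a, na, n^2a$ with $a$ a positive integer and $n>1$ an integer. $G_3^*=\{1,2,3,5,6,7,8,10,\dots\}$ is built greedily: going through $1,2,3,\dots$ in order, each integer is included unless it is the largest term of a three-term geometric progression whose two smaller terms are already included. (Rankin showed that $G_3^*$ is exactly the set of positive integers $m$ such that for every prime $p$ dividing $m$, the exponent of $p$ in $m$ lies in $A_3^*$, the set of nonnegative integers having no digit $2$ in base $3$.) For $A\subseteq\mathbb{N}$, the upper uniform density is $\overline{u}(A)=\lim_{s\to\infty}\max_{n\ge 0}\frac{1}{s}\#\{a\in A: n<a\le n+s\}$. -}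

module Defs where

open import Data.Nat using (ℕ; zero; suc; _+_; _*_; _≡ᵇ_)
open import Data.Bool using (Bool; true; false; if_then_else_; not; _∧_)
open import Data.List using (List; upTo; drop; map)
open import Data.Bool.ListAction using (any)
open import Data.Nat.ListAction using (sum)

-- bad f m = true iff m is the largest term n²a of a 3-term geometric
-- progression a, na, n²a (a ≥ 1, n ≥ 2) whose two smaller terms a, na
-- are marked by f.  (a = 0 never matches since m ≥ 1 when used.)
bad : (ℕ → Bool) → ℕ → Bool
bad f m = any (λ n → any (λ a → (n * n * a ≡ᵇ m) ∧ (f a ∧ f (n * a)))
                         (upTo (suc m)))
              (drop 2 (upTo (suc m)))

-- build m x : membership of x in the greedy set after processing 1..m
-- (false for all x > m and for x = 0).
build : ℕ → ℕ → Bool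
build zero x = false
build (suc m) x =
  if x ≡ᵇ suc m then not (bad (build m) (suc m)) else build m x

G3 : ℕ → Bool
G3 m = build m m

countG3 : ℕ → ℕ → ℕ
countG3 n s = sum (map (λ i → if G3 (n + suc i) then 1 else 0) (upTo s))

-- ū(G₃*) ≤ 7/8, written out: for every ε = 1/k (k ≥ 1) there is S such
-- that for all s ≥ S and all n, countG3 n s / s ≤ 7/8 + 1/k,
-- i.e. 8k · countG3 n s ≤ (7k + 8) · s.

{-# OPTIONS --safe #-}
-- For odd u, 2u ∈ G₃* iff u ∈ G₃*: a progression whose top is u or 2u has an odd
-- ratio, so the factor 2 only moves its base between b and 2b, and strong induction
-- on u closes the argument.  Hence 4u ∉ G₃* for odd u: either u, 2u ∈ G₃* and
-- 4u = 2²u, or u = n²a with a, na ∈ G₃* and then 4u = (2n)²a with 2na ∈ G₃*.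
-- Every 8 consecutive integers contain such a 4u, so an interval of length s
-- meets G₃* in at most (7s + 7)/8 points.
module Submission where

open import Defs
open import Data.Nat using (ℕ; suc; _+_; _*_; _≤_)
open import Data.Product using (∃-syntax)

open import Data.Bool using (Bool; true; false; not; T; _∧_; if_then_else_)
open import Data.Bool.ListAction using (any)
open import Data.Bool.Properties using (T-≡; T-∧; not-injective)
open import Data.List using ([]; _∷_; upTo; applyUpTo; map)
open import Data.List.Membership.Propositional using (find; lose)
open import Data.List.Membership.Propositional.Properties using (∈-applyUpTo⁻; ∈-applyUpTo⁺; ∈-upTo⁺)
open import Data.List.Properties using (map-upTo; map-∘; map-cong)
open import Data.List.Relation.Unary.Any.Properties using (any⁺; any⁻)
open import Data.Nat using (zero; _<_; _≡ᵇ_; s≤s; z≤n; s≤s⁻¹)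
open import Data.Nat.DivMod using (_/_; m≡m%n+[m/n]*n; m%n<n)
open import Data.Nat.Divisibility
  using (_∣_; _∤_; divides; _∣0; ∣m+n∣m⇒∣n; ∣1⇒≡1; n∣m*n; ∣m⇒∣m*n; ∣n⇒∣m*n; m∣m*n; *-pres-∣; *-cancelˡ-∣)
open import Data.Nat.Induction using (<-rec)
open import Data.Nat.ListAction using (sum)
open import Data.Nat.Primality using (euclidsLemma; prime[2])
open import Data.Nat.Properties
open import Algebra.Properties.CommutativeSemigroup *-commutativeSemigroup using (x∙yz≈y∙xz)
open import Data.Nat.Tactic.RingSolver using (solve)
open import Data.Product using (_×_; _,_)
open import Data.Sum using (inj₁; inj₂; [_,_]′)
open import Function using (_∘_; id)
open import Function.Bundles using (Equivalence)
open import Relation.Binary.PropositionalEquality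
open import Relation.Nullary using (contradiction)

open Equivalence using (to; from)

largest-term? : (ℕ → Bool) → ℕ → ℕ → ℕ → Bool
largest-term? f m n a = (n * n * a ≡ᵇ m) ∧ (f a ∧ f (n * a))

has-base? : (ℕ → Bool) → ℕ → ℕ → Bool
has-base? f m n = any (largest-term? f m n) (upTo (suc m))

bad-sound : ∀ f m → T (bad f m) →
            ∃[ n ] ∃[ a ] (2 ≤ n × n * n * a ≡ m × T (f a) × T (f (n * a)))
bad-sound f m@(suc (suc m-2)) bad-m
  with n , n∈ , some-a ← find (any⁻ (has-base? f m) (applyUpTo (suc ∘ suc) (suc m-2)) bad-m)
  with i , _ , refl ← ∈-applyUpTo⁻ (suc ∘ suc) n∈
  with a , _ , ok ← find (any⁻ (largest-term? f m n) (upTo (suc m)) some-a)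
  with top , fa∧fna ← to T-∧ ok
  with fa , fna ← to T-∧ fa∧fna
  = n , a , s≤s (s≤s z≤n) , ≡ᵇ⇒≡ _ _ top , fa , fna

bad-complete : ∀ f {m n a} → 2 ≤ n → a ≤ m → n ≤ m → n * n * a ≡ m →
               T (f a) → T (f (n * a)) → T (bad f m)
bad-complete f {m@(suc (suc _))} {n} (s≤s (s≤s _)) a≤m (s≤s (s≤s i≤m-2)) top fa fna =
  any⁺ (has-base? f m) (lose (∈-applyUpTo⁺ (suc ∘ suc) (s≤s i≤m-2))
    (any⁺ (largest-term? f m n) (lose (∈-upTo⁺ (s≤s a≤m))
      (from T-∧ (≡⇒≡ᵇ _ _ top , from T-∧ (fa , fna))))))
bad-complete f {suc zero} (s≤s (s≤s _)) _ (s≤s ())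

build-stable : ∀ m {x} → x ≤ m → build m x ≡ G3 x
build-stable m {x} x≤m with m≤n⇒m<n∨m≡n x≤m
... | inj₂ refl = refl
build-stable (suc m) {x} _ | inj₁ (s≤s x≤m) with x ≡ᵇ suc m in x≡ᵇ1+m
... | true  = contradiction (≡ᵇ⇒≡ x (suc m) (from T-≡ x≡ᵇ1+m)) (<⇒≢ (s≤s x≤m))
... | false = build-stable m x≤m

G3-suc : ∀ m → G3 (suc m) ≡ not (bad (build m) (suc m))
G3-suc m rewrite to T-≡ (≡⇒≡ᵇ m m refl) = refl

record TopOfG3Progression (m : ℕ) : Set where
  constructor progression
  field
    ratio base : ℕ
    2≤ratio    : 2 ≤ ratio
    top≡       : ratio * ratio * base ≡ m
    base∈G3    : G3 base ≡ true
    middle∈G3  : G3 (ratio * base) ≡ true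

base>0 : ∀ n {a m} → n * n * a ≡ m → 0 < m → 0 < a
base>0 n {zero} top 0<m rewrite *-zeroʳ (n * n) = contradiction top (<⇒≢ 0<m)
base>0 n {suc a} _ _ = s≤s z≤n

base≤middle : ∀ {n} a → 2 ≤ n → a ≤ n * a
base≤middle {n@(suc _)} a _ = m≤n*m a n

middle<top : ∀ {n a} → 2 ≤ n → 0 < a → n * a < n * n * a
middle<top {n@(suc _)} {a@(suc _)} 2≤n _ = begin-strict
  n * a       <⟨ m<m*n (n * a) n 2≤n ⟩
  n * a * n   ≡⟨ *-comm (n * a) n ⟩
  n * (n * a) ≡⟨ *-assoc n n a ⟨
  n * n * a   ∎
  where open ≤-Reasoning

ratio≤middle : ∀ n {a} → 0 < a → n ≤ n * a
ratio≤middle n {a@(suc _)} _ = m≤m*n n a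

lower-terms-< : ∀ {m n a} → 2 ≤ n → n * n * a ≡ m → 0 < m → a < m × n < m × n * a < m
lower-terms-< {m} {n} {a} 2≤n top 0<m =
  ≤-<-trans (base≤middle a 2≤n) na<m , ≤-<-trans (ratio≤middle n 0<a) na<m , na<m
  where
  0<a : 0 < a
  0<a = base>0 n top 0<m
  na<m : n * a < m
  na<m = subst (n * a <_) top (middle<top 2≤n 0<a)

TopOfG3Progression⇒∉G3 : ∀ {m} → TopOfG3Progression m → G3 m ≡ false
TopOfG3Progression⇒∉G3 {zero} _ = refl
TopOfG3Progression⇒∉G3 {suc m} (progression n a 2≤n top a∈ na∈)
  with a<1+m , n<1+m , na<1+m ← lower-terms-< 2≤n top (s≤s z≤n)
  = trans (G3-suc m) (cong not (to T-≡ (bad-complete (build m) 2≤n (<⇒≤ a<1+m) (<⇒≤ n<1+m) top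
                                           (∈build (s≤s⁻¹ a<1+m) a∈) (∈build (s≤s⁻¹ na<1+m) na∈))))
  where
  ∈build : ∀ {x} → x ≤ m → G3 x ≡ true → T (build m x)
  ∈build x≤m x∈ = from T-≡ (trans (build-stable m x≤m) x∈)

∉G3⇒TopOfG3Progression : ∀ {m} → 0 < m → G3 m ≡ false → TopOfG3Progression m
∉G3⇒TopOfG3Progression {suc m} _ m∉
  with n , a , 2≤n , top , a∈ , na∈ ← bad-sound (build m) (suc m)
                                         (from T-≡ (not-injective (trans (sym (G3-suc m)) m∉)))
  with a<1+m , _ , na<1+m ← lower-terms-< 2≤n top (s≤s z≤n)
  = progression n a 2≤n top (∈G3 (s≤s⁻¹ a<1+m) a∈) (∈G3 (s≤s⁻¹ na<1+m) na∈)
  where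
  ∈G3 : ∀ {x} → x ≤ m → T (build m x) → G3 x ≡ true
  ∈G3 x≤m x∈ = trans (sym (build-stable m x≤m)) (to T-≡ x∈)

∤m*n⇒∤n : ∀ {d} m n → d ∤ m * n → d ∤ n
∤m*n⇒∤n m n d∤m*n d∣n = d∤m*n (∣n⇒∣m*n m d∣n)

∤⇒>0 : ∀ {d n} → d ∤ n → 0 < n
∤⇒>0 {d} {zero} d∤0 = contradiction (d ∣0) d∤0
∤⇒>0 {n = suc _} _ = s≤s z≤n

∤top⇒∤base : ∀ {d} n {a m} → n * n * a ≡ m → d ∤ m → d ∤ a
∤top⇒∤base n top d∤m = ∤m*n⇒∤n (n * n) _ (subst (_ ∤_) (sym top) d∤m)

∤top⇒∤middle : ∀ {d} n {a m} → n * n * a ≡ m → d ∤ m → d ∤ n * a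
∤top⇒∤middle n {a} top d∤m = ∤m*n⇒∤n n (n * a) (subst (_ ∤_) (sym (trans (sym (*-assoc n n a)) top)) d∤m)

≡-by-false : ∀ {x y : Bool} → (x ≡ false → y ≡ false) → (y ≡ false → x ≡ false) → x ≡ y
≡-by-false {true}  {true}  _ _ = refl
≡-by-false {true}  {false} _ y⇒x = y⇒x refl
≡-by-false {false} {true}  x⇒y _ = sym (x⇒y refl)
≡-by-false {false} {false} _ _ = refl

module Doubling {u} (u-odd : 2 ∤ u)
                (halving : ∀ {v} → v < u → 2 ∤ v → G3 (2 * v) ≡ G3 v) where

  0<u : 0 < u
  0<u = ∤⇒>0 u-odd

  base-even : ∀ n {a} → n * n * a ≡ 2 * u → 2 ∣ a
  base-even n {a} top with euclidsLemma (n * n) a prime[2] (subst (2 ∣_) (sym top) (m∣m*n u))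
  ... | inj₂ 2∣a   = 2∣a
  ... | inj₁ 2∣n*n = contradiction ([ id , id ]′ (euclidsLemma n n prime[2] 2∣n*n)) n-odd
    where
    n-odd : 2 ∤ n
    n-odd 2∣n = u-odd (*-cancelˡ-∣ 2 (subst (2 * 2 ∣_) top (∣m⇒∣m*n a (*-pres-∣ 2∣n 2∣n))))

  halved-top : ∀ n {a b} → n * n * a ≡ 2 * u → a ≡ b * 2 → n * n * b ≡ u
  halved-top n {a} {b} top a≡b*2 = *-cancelˡ-≡ (n * n * b) u 2 (begin
    2 * (n * n * b) ≡⟨ solve (n ∷ b ∷ []) ⟩
    n * n * (b * 2) ≡⟨ cong (n * n *_) a≡b*2 ⟨
    n * n * a       ≡⟨ top ⟩
    2 * u           ∎)
    where open ≡-Reasoning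

  ∉G3⇒double-∉G3 : G3 u ≡ false → G3 (2 * u) ≡ false
  ∉G3⇒double-∉G3 u∉
    with progression n a 2≤n top a∈ na∈ ← ∉G3⇒TopOfG3Progression (∤⇒>0 u-odd) u∉
    with a<u , _ , na<u ← lower-terms-< 2≤n top 0<u
    = TopOfG3Progression⇒∉G3 (progression n (2 * a) 2≤n top₂ 2a∈ n2a∈)
    where
    top₂ : n * n * (2 * a) ≡ 2 * u
    top₂ = begin
      n * n * (2 * a) ≡⟨ solve (n ∷ a ∷ []) ⟩
      2 * (n * n * a) ≡⟨ cong (2 *_) top ⟩
      2 * u           ∎
      where open ≡-Reasoning
    2a∈ : G3 (2 * a) ≡ true
    2a∈ = trans (halving a<u (∤top⇒∤base n top u-odd)) a∈
    n2a∈ : G3 (n * (2 * a)) ≡ true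
    n2a∈ = begin
      G3 (n * (2 * a)) ≡⟨ cong G3 (x∙yz≈y∙xz n 2 a) ⟩
      G3 (2 * (n * a)) ≡⟨ halving na<u (∤top⇒∤middle n top u-odd) ⟩
      G3 (n * a)       ≡⟨ na∈ ⟩
      true             ∎
      where open ≡-Reasoning

  double-∉G3⇒∉G3 : G3 (2 * u) ≡ false → G3 u ≡ false
  double-∉G3⇒∉G3 2u∉
    with progression n a 2≤n top a∈ na∈ ← ∉G3⇒TopOfG3Progression (≤-trans 0<u (m≤n*m u 2)) 2u∉
    with divides b a≡b*2 ← base-even n top
    with b<u , _ , nb<u ← lower-terms-< 2≤n (halved-top n top a≡b*2) 0<u
    = TopOfG3Progression⇒∉G3 (progression n b 2≤n topᵤ b∈ nb∈)
    where
    topᵤ : n * n * b ≡ u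
    topᵤ = halved-top n top a≡b*2
    2b≡a : 2 * b ≡ a
    2b≡a = trans (*-comm 2 b) (sym a≡b*2)
    b∈ : G3 b ≡ true
    b∈ = begin
      G3 b       ≡⟨ halving b<u (∤top⇒∤base n topᵤ u-odd) ⟨
      G3 (2 * b) ≡⟨ cong G3 2b≡a ⟩
      G3 a       ≡⟨ a∈ ⟩
      true       ∎
      where open ≡-Reasoning
    nb∈ : G3 (n * b) ≡ true
    nb∈ = begin
      G3 (n * b)       ≡⟨ halving nb<u (∤top⇒∤middle n topᵤ u-odd) ⟨
      G3 (2 * (n * b)) ≡⟨ cong G3 (trans (x∙yz≈y∙xz 2 n b) (cong (n *_) 2b≡a)) ⟩
      G3 (n * a)       ≡⟨ na∈ ⟩
      true             ∎
      where open ≡-Reasoning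

G3-double-odd : ∀ u → 2 ∤ u → G3 (2 * u) ≡ G3 u
G3-double-odd = <-rec _ λ u halving u-odd →
  let open Doubling u-odd halving in ≡-by-false double-∉G3⇒∉G3 ∉G3⇒double-∉G3

G3-four-odd : ∀ u → 2 ∤ u → G3 (4 * u) ≡ false
G3-four-odd u u-odd with G3 u in u∈
... | true  = TopOfG3Progression⇒∉G3
                (progression 2 u ≤-refl refl u∈ (trans (G3-double-odd u u-odd) u∈))
... | false with progression n a 2≤n top a∈ na∈ ← ∉G3⇒TopOfG3Progression (∤⇒>0 u-odd) u∈
  = TopOfG3Progression⇒∉G3 (progression (2 * n) a (≤-trans 2≤n (m≤n*m n 2)) top₄ a∈ 2na∈)
  where
  open ≡-Reasoning
  top₄ : 2 * n * (2 * n) * a ≡ 4 * u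
  top₄ = begin
    2 * n * (2 * n) * a ≡⟨ solve (n ∷ a ∷ []) ⟩
    4 * (n * n * a)     ≡⟨ cong (4 *_) top ⟩
    4 * u               ∎
  2na∈ : G3 (2 * n * a) ≡ true
  2na∈ = begin
    G3 (2 * n * a)   ≡⟨ cong G3 (*-assoc 2 n a) ⟩
    G3 (2 * (n * a)) ≡⟨ G3-double-odd (n * a) (∤top⇒∤middle n top u-odd) ⟩
    G3 (n * a)       ≡⟨ na∈ ⟩
    true             ∎

2∤q*2+1 : ∀ q → 2 ∤ q * 2 + 1
2∤q*2+1 q 2∣2q+1 = contradiction (∣1⇒≡1 (∣m+n∣m⇒∣n 2∣2q+1 (n∣m*n q))) λ ()

window-meets-4·odd : ∀ n → ∃[ i ] ∃[ q ] (i < 8 × n + suc i ≡ 4 * (q * 2 + 1))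
window-meets-4·odd zero = 3 , 0 , s≤s (s≤s (s≤s (s≤s z≤n))) , refl
window-meets-4·odd (suc n) with window-meets-4·odd n
... | suc i , q , i<8 , eq = i , q , <-trans (n<1+n i) i<8 , trans (sym (+-suc n (suc i))) eq
... | zero  , q , _   , eq = 7 , suc q , ≤-refl , (begin
  suc n + 8               ≡⟨ solve (n ∷ []) ⟩
  n + 1 + 8               ≡⟨ cong (_+ 8) eq ⟩
  4 * (q * 2 + 1) + 8     ≡⟨ solve (q ∷ []) ⟩
  4 * (suc q * 2 + 1)     ∎)
  where open ≡-Reasoning

indicatorG3 : ℕ → ℕ
indicatorG3 x = if G3 x then 1 else 0

indicatorG3≤1 : ∀ x → indicatorG3 x ≤ 1
indicatorG3≤1 x with G3 x
... | true  = ≤-refl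
... | false = z≤n

countG3-suc : ∀ n s → countG3 n (suc s) ≡ indicatorG3 (n + 1) + countG3 (suc n) s
countG3-suc n s = cong (indicatorG3 (n + 1) +_) (begin
  sum (map h (applyUpTo suc s))   ≡⟨ cong (sum ∘ map h) (map-upTo suc s) ⟨
  sum (map h (map suc (upTo s)))  ≡⟨ cong sum (map-∘ (upTo s)) ⟨
  sum (map (h ∘ suc) (upTo s))    ≡⟨ cong sum (map-cong (λ i → cong indicatorG3 (+-suc n (suc i))) (upTo s)) ⟩
  countG3 (suc n) s               ∎)
  where
  open ≡-Reasoning
  h : ℕ → ℕ
  h i = indicatorG3 (n + suc i)

countG3-+ : ∀ n a s → countG3 n (a + s) ≡ countG3 n a + countG3 (n + a) s
countG3-+ n zero s = cong (λ m → countG3 m s) (sym (+-identityʳ n))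
countG3-+ n (suc a) s = begin
  countG3 n (suc (a + s))                                      ≡⟨ countG3-suc n (a + s) ⟩
  x + countG3 (suc n) (a + s)                                  ≡⟨ cong (x +_) (countG3-+ (suc n) a s) ⟩
  x + (countG3 (suc n) a + countG3 (suc n + a) s)              ≡⟨ +-assoc x _ _ ⟨
  x + countG3 (suc n) a + countG3 (suc n + a) s                ≡⟨ cong₂ _+_ (countG3-suc n a) (cong (λ m → countG3 m s) (+-suc n a)) ⟨
  countG3 n (suc a) + countG3 (n + suc a) s                    ∎
  where
  open ≡-Reasoning
  x : ℕ
  x = indicatorG3 (n + 1)

countG3≤ : ∀ n s → countG3 n s ≤ s
countG3≤ n zero    = z≤n
countG3≤ n (suc s) rewrite countG3-suc n s = +-mono-≤ (indicatorG3≤1 (n + 1)) (countG3≤ (suc n) s)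

countG3-gap : ∀ n {i s} → G3 (n + suc i) ≡ false → i < s → countG3 n s < s
countG3-gap n {zero} {suc s} gap _ rewrite countG3-suc n s | gap = s≤s (countG3≤ (suc n) s)
countG3-gap n {suc i} {suc s} gap (s≤s i<s) rewrite countG3-suc n s =
  +-mono-≤-< (indicatorG3≤1 (n + 1)) (countG3-gap (suc n) (trans (cong G3 (sym (+-suc n (suc i)))) gap) i<s)

countG3-window8 : ∀ n → countG3 n 8 ≤ 7
countG3-window8 n with i , q , i<8 , eq ← window-meets-4·odd n =
  s≤s⁻¹ (countG3-gap n (trans (cong G3 eq) (G3-four-odd (q * 2 + 1) (2∤q*2+1 q))) i<8)

countG3-blocks : ∀ q n → countG3 n (q * 8) ≤ q * 7
countG3-blocks zero    n = z≤n
countG3-blocks (suc q) n = subst (_≤ 7 + q * 7) (sym (countG3-+ n 8 (q * 8)))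
  (+-mono-≤ (countG3-window8 n) (countG3-blocks q (n + 8)))

countG3-bound-mod8 : ∀ n q {r} → r ≤ 7 → 8 * countG3 n (r + q * 8) ≤ 7 * (r + q * 8) + 7
countG3-bound-mod8 n q {r} r≤7 = begin
  8 * countG3 n (r + q * 8)                   ≡⟨ cong (8 *_) (countG3-+ n r (q * 8)) ⟩
  8 * (countG3 n r + countG3 (n + r) (q * 8)) ≤⟨ *-monoʳ-≤ 8 (+-mono-≤ (countG3≤ n r) (countG3-blocks q (n + r))) ⟩
  8 * (r + q * 7)                             ≡⟨ solve (r ∷ q ∷ []) ⟩
  r + 7 * (r + q * 8)                         ≤⟨ +-monoˡ-≤ (7 * (r + q * 8)) r≤7 ⟩
  7 + 7 * (r + q * 8)                         ≡⟨ +-comm 7 _ ⟩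
  7 * (r + q * 8) + 7                         ∎
  where open ≤-Reasoning

countG3-bound : ∀ n s → 8 * countG3 n s ≤ 7 * s + 7
countG3-bound n s = subst (λ t → 8 * countG3 n t ≤ 7 * t + 7) (sym (m≡m%n+[m/n]*n s 8))
  (countG3-bound-mod8 n (s / 8) (s≤s⁻¹ (m%n<n s 8)))

scaled-bound : ∀ k {s c} → 8 * c ≤ 7 * s + 7 → suc k ≤ s → 8 * suc k * c ≤ (7 * suc k + 8) * s
scaled-bound k {s} {c} 8c≤7s+7 1+k≤s = begin
  8 * suc k * c             ≡⟨ solve (k ∷ c ∷ []) ⟩
  suc k * (8 * c)           ≤⟨ *-monoʳ-≤ (suc k) 8c≤7s+7 ⟩
  suc k * (7 * s + 7)       ≡⟨ solve (k ∷ s ∷ []) ⟩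
  7 * suc k * s + 7 * suc k ≤⟨ +-monoʳ-≤ (7 * suc k * s) (*-mono-≤ (n≤1+n 7) 1+k≤s) ⟩
  7 * suc k * s + 8 * s     ≡⟨ solve (k ∷ s ∷ []) ⟩
  (7 * suc k + 8) * s       ∎
  where open ≤-Reasoning

mainTheorem1 : (k : ℕ) → ∃[ S ] ((s n : ℕ) → S ≤ s →
                 8 * suc k * countG3 n s ≤ (7 * suc k + 8) * s)
mainTheorem1 k = suc k , λ s n → scaled-bound k (countG3-bound n s)
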